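{- Let $d\ge 1$ and let $\mathcal{F}\subseteq\binom{[2d]}{d}$. If $\mathcal{F}$ almost shatters every $A\in\binom{[2d]}{d}$, then $\mathcal{F}$ is $(d-1)$-saturated (as a family in $2^{[2d]}$).
   Context: $\binom{[2d]}{d}$ is the set of $d$-element subsets of $[2d]$. For a family $\mathcal{F}$ and set $X$, $\mathcal{F}|_X=\{F\cap X:F\in\mathcal{F}\}$; $\mathcal{F}$ shatters $X$ if $\mathcal{F}|_X=2^X$, and almost shatters $X$ if $\mathcal{F}|_X=2^X\setminus\{\emptyset\}$ or $\mathcal{F}|_X=2^X\setminus\{X\}$. $VC(\mathcal{F})$ is the largest size of a set shattered by $\mathcal{F}$. A family $\mathcal{F}\subseteq 2^{[2d]}$ is $(d-1)$-saturated if $VC(\mathcal{F})=d-1$ and $VC(\mathcal{F}')>VC(\mathcal{F})$ for every $\mathcal{F}'\subseteq 2^{[2d]}$ with $\mathcal{F}'\supsetneq\mathcal{F}$. -}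

module Defs where

open import Level using (Level; suc; _⊔_)
open import Data.Nat using (ℕ; _≤_; _<_)
open import Data.Fin.Subset using (Subset; _∩_; _⊆_; ∣_∣; ⊥)
open import Data.Product using (Σ; _×_; ∃)
open import Relation.Binary.PropositionalEquality using (_≡_)
open import Relation.Nullary using (¬_)
open import Function.Bundles using (_⇔_)
open import Data.Sum using (_⊎_)

Family : ∀ ℓ → ℕ → Set (suc ℓ)
Family ℓ n = Subset n → Set ℓ

module _ {ℓ : Level} {n : ℕ} where

  InTrace : Family ℓ n → Subset n → Subset n → Set ℓ
  InTrace 𝓕 X Y = ∃ λ F → 𝓕 F × (F ∩ X) ≡ Y

  Shatters : Family ℓ n → Subset n → Set ℓ
  Shatters 𝓕 X = ∀ Y → Y ⊆ X → InTrace 𝓕 X Y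

  -- 𝓕 almost shatters X : 𝓕|_X = 2^X ∖ {∅}  or  𝓕|_X = 2^X ∖ {X}
  -- (every trace F ∩ X is automatically a subset of X)
  AlmostShatters : Family ℓ n → Subset n → Set ℓ
  AlmostShatters 𝓕 X =
      (∀ Y → Y ⊆ X → (InTrace 𝓕 X Y ⇔ (¬ Y ≡ ⊥)))
    ⊎ (∀ Y → Y ⊆ X → (InTrace 𝓕 X Y ⇔ (¬ Y ≡ X)))

  VCEq : Family ℓ n → ℕ → Set ℓ
  VCEq 𝓕 k = (∃ λ X → ∣ X ∣ ≡ k × Shatters 𝓕 X) × (∀ X → Shatters 𝓕 X → ∣ X ∣ ≤ k)

  VCGt : Family ℓ n → ℕ → Set ℓ
  VCGt 𝓕 k = ∃ λ X → k < ∣ X ∣ × Shatters 𝓕 X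

  _⊑_ : Family ℓ n → Family ℓ n → Set ℓ
  𝓕 ⊑ 𝓖 = ∀ S → 𝓕 S → 𝓖 S

  _⊏_ : Family ℓ n → Family ℓ n → Set ℓ
  𝓕 ⊏ 𝓖 = 𝓕 ⊑ 𝓖 × ∃ λ S → 𝓖 S × ¬ 𝓕 S

  Saturated : ℕ → Family ℓ n → Set (suc ℓ)
  Saturated k 𝓕 = VCEq 𝓕 k × (∀ (𝓕' : Family ℓ n) → 𝓕 ⊏ 𝓕' → VCGt 𝓕' k)

module Submission where

-- If 𝓕 almost shatters a set B, it shatters every proper subset X ⊂ B: for
-- x ∈ B ∖ X, the trace Y ∪ {x} or Y on B restricts to Y on X. Hence every set of size
-- below d is shattered, while no d-set is (its trace misses ∅ or itself) and no larger set
-- is (a member of 𝓕 would contain it). A new set S completes some d-set A, whose traces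
-- under 𝓕 miss only ∅ or A: for |S| = d take A = S (the trace S cannot come from 𝓕, else
-- S ∈ 𝓕); for |S| < d take A ∈ 𝓕 disjoint from the shattered set S; for |S| > d take
-- A = ∁ G for some G ∈ 𝓕 containing the shattered set ∁ S.

open import Defs
open import Level using (Level; 0ℓ)
open import Data.Nat using (ℕ; zero; suc; _≤_; _<_; _+_; _*_; _∸_; s≤s; z≤n; _≤?_)
open import Data.Nat.Properties
  using (≤-refl; ≤-reflexive; ≤-trans; ≤-antisym; ≤-pred; <-irrefl; <⇒≤; <⇒≱; ≰⇒>; n<1+n; n≤1+n; m≤m+n; m+n∸m≡n; +-identityʳ; ∸-monoʳ-<; <-cmp)
open import Data.Fin using (Fin)
open import Data.Fin.Subset
  using (Subset; _∈_; _∉_; _⊆_; _⊂_; _∩_; _∪_; ∁; ⊥; ⁅_⁆; ∣_∣; inside; outside)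
open import Data.Fin.Subset.Properties
open import Data.Vec using (_∷_; [])
open import Data.Product using (∃; _×_; _,_)
open import Data.Sum using (_⊎_; inj₁; inj₂)
open import Relation.Binary.Definitions using (tri<; tri≈; tri>)
open import Relation.Binary.PropositionalEquality
  using (_≡_; _≢_; refl; sym; trans; cong; cong₂; subst; subst₂; module ≡-Reasoning)
open import Data.Empty using (⊥-elim)
open import Relation.Nullary using (¬_; yes; no; contradiction)
open import Function using (_∘_)
open import Function.Bundles using (Equivalence)

open Equivalence using (to; from)

module _ {n : ℕ} {p q : Subset n} where

  ⊆⇒≡⊎⊂ : p ⊆ q → p ≡ q ⊎ p ⊂ q
  ⊆⇒≡⊎⊂ p⊆q with p ⊂? q
  ... | yes p⊂q = inj₂ p⊂q
  ... | no p⊄q = inj₁ (⊆-antisym p⊆q q⊆p)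
    where
    q⊆p : q ⊆ p
    q⊆p {x} x∈q with x ∈? p
    ... | yes x∈p = x∈p
    ... | no x∉p = ⊥-elim (p⊄q (p⊆q , x , x∈q , x∉p))

  p⊆q∧∣p∣<∣q∣⇒p⊂q : p ⊆ q → ∣ p ∣ < ∣ q ∣ → p ⊂ q
  p⊆q∧∣p∣<∣q∣⇒p⊂q p⊆q ∣p∣<∣q∣ with ⊆⇒≡⊎⊂ p⊆q
  ... | inj₁ refl = contradiction ∣p∣<∣q∣ (<-irrefl refl)
  ... | inj₂ p⊂q = p⊂q

  p⊆q∧∣q∣≤∣p∣⇒p≡q : p ⊆ q → ∣ q ∣ ≤ ∣ p ∣ → p ≡ q
  p⊆q∧∣q∣≤∣p∣⇒p≡q p⊆q ∣q∣≤∣p∣ with ⊆⇒≡⊎⊂ p⊆q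
  ... | inj₁ p≡q = p≡q
  ... | inj₂ p⊂q = contradiction ∣q∣≤∣p∣ (<⇒≱ (p⊂q⇒∣p∣<∣q∣ p⊂q))

  p⊆q⇒p∩q≡p : p ⊆ q → p ∩ q ≡ p
  p⊆q⇒p∩q≡p p⊆q = ⊆-antisym (p∩q⊆p p q) (λ x∈p → x∈p∩q⁺ (x∈p , p⊆q x∈p))

  p∩q≡q⇒q⊆p : p ∩ q ≡ q → q ⊆ p
  p∩q≡q⇒q⊆p p∩q≡q x∈q = p∩q⊆p p q (subst (_ ∈_) (sym p∩q≡q) x∈q)

  ∁p⊆q⇒∁q⊆p : ∁ p ⊆ q → ∁ q ⊆ p
  ∁p⊆q⇒∁q⊆p ∁p⊆q x∈∁q = x∉∁p⇒x∈p (x∈∁p⇒x∉p x∈∁q ∘ ∁p⊆q)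

x∉p⇒⁅x⁆∩p≡⊥ : ∀ {n} {x : Fin n} {p : Subset n} → x ∉ p → ⁅ x ⁆ ∩ p ≡ ⊥
x∉p⇒⁅x⁆∩p≡⊥ {x = x} {p} x∉p = ⊆-antisym ⁅x⁆∩p⊆⊥ ⊥⊆
  where
  ⁅x⁆∩p⊆⊥ : ⁅ x ⁆ ∩ p ⊆ ⊥
  ⁅x⁆∩p⊆⊥ y∈⁅x⁆∩p with x∈p∩q⁻ ⁅ x ⁆ p y∈⁅x⁆∩p
  ... | y∈⁅x⁆ , y∈p rewrite x∈⁅y⁆⇒x≡y x y∈⁅x⁆ = contradiction y∈p x∉p

0<∣p∣⇒p≢⊥ : ∀ {n} {p : Subset n} → 0 < ∣ p ∣ → p ≢ ⊥
0<∣p∣⇒p≢⊥ {n} 0<∣p∣ refl = <-irrefl (sym (∣⊥∣≡0 n)) 0<∣p∣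

∃-superset-of-size : ∀ {n} (p : Subset n) k → ∣ p ∣ ≤ k → k ≤ n → ∃ λ q → p ⊆ q × ∣ q ∣ ≡ k
∃-superset-of-size [] zero _ _ = [] , (λ ()) , refl
∃-superset-of-size (inside ∷ p) (suc k) (s≤s ∣p∣≤k) (s≤s k≤n)
  with q , p⊆q , ∣q∣≡k ← ∃-superset-of-size p k ∣p∣≤k k≤n
  = inside ∷ q , in⊆in p⊆q , cong suc ∣q∣≡k
∃-superset-of-size {suc n} (outside ∷ p) k ∣p∣≤k k≤1+n with k ≤? n
... | yes k≤n with q , p⊆q , ∣q∣≡k ← ∃-superset-of-size p k ∣p∣≤k k≤n
  = outside ∷ q , out⊆ p⊆q , ∣q∣≡k
... | no k≰n with q , p⊆q , ∣q∣≡n ← ∃-superset-of-size p n (∣p∣≤n p) ≤-refl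
  = inside ∷ q , out⊆ p⊆q , trans (cong suc ∣q∣≡n) (≤-antisym (≰⇒> k≰n) k≤1+n)

module _ {ℓ : Level} {n : ℕ} {𝓕 : Family ℓ n} where

  InTrace-mono : ∀ {𝓖 X Y} → 𝓕 ⊑ 𝓖 → InTrace 𝓕 X Y → InTrace 𝓖 X Y
  InTrace-mono 𝓕⊑𝓖 (F , 𝓕F , F∩X≡Y) = F , 𝓕⊑𝓖 F 𝓕F , F∩X≡Y

  InTrace-restrict : ∀ {A X Y} → X ⊆ A → InTrace 𝓕 A Y → InTrace 𝓕 X (Y ∩ X)
  InTrace-restrict {A} {X} {Y} X⊆A (F , 𝓕F , F∩A≡Y) = F , 𝓕F , F∩X≡Y∩X
    where
    open ≡-Reasoning
    F∩X≡Y∩X : F ∩ X ≡ Y ∩ X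
    F∩X≡Y∩X = begin
      F ∩ X         ≡⟨ cong (F ∩_) (sym (trans (∩-comm A X) (p⊆q⇒p∩q≡p X⊆A))) ⟩
      F ∩ (A ∩ X)   ≡⟨ sym (∩-assoc F A X) ⟩
      (F ∩ A) ∩ X   ≡⟨ cong (_∩ X) F∩A≡Y ⟩
      Y ∩ X         ∎

  Shatters⇒⊆member : ∀ {X} → Shatters 𝓕 X → ∃ λ F → 𝓕 F × X ⊆ F
  Shatters⇒⊆member sh with F , 𝓕F , F∩X≡X ← sh _ ⊆-refl = F , 𝓕F , p∩q≡q⇒q⊆p F∩X≡X

  AlmostShatters⇒¬Shatters : ∀ {A} → AlmostShatters 𝓕 A → ¬ Shatters 𝓕 A
  AlmostShatters⇒¬Shatters (inj₁ h) sh = to (h ⊥ ⊥⊆) (sh ⊥ ⊥⊆) refl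
  AlmostShatters⇒¬Shatters (inj₂ h) sh = to (h _ ⊆-refl) (sh _ ⊆-refl) refl

  AlmostShatters⇒Shatters-⊂ : ∀ {B X} → AlmostShatters 𝓕 B → X ⊂ B → Shatters 𝓕 X
  AlmostShatters⇒Shatters-⊂ {B} {X} (inj₁ h) (X⊆B , x , x∈B , x∉X) Y Y⊆X =
    subst (InTrace 𝓕 X) Y∪x∩X≡Y (InTrace-restrict X⊆B (from (h (Y ∪ ⁅ x ⁆) Y∪x⊆B) Y∪x≢⊥))
    where
    open ≡-Reasoning
    Y∪x⊆B : Y ∪ ⁅ x ⁆ ⊆ B
    Y∪x⊆B y∈ with x∈p∪q⁻ Y ⁅ x ⁆ y∈
    ... | inj₁ y∈Y = X⊆B (Y⊆X y∈Y)
    ... | inj₂ y∈⁅x⁆ rewrite x∈⁅y⁆⇒x≡y x y∈⁅x⁆ = x∈B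
    Y∪x≢⊥ : Y ∪ ⁅ x ⁆ ≢ ⊥
    Y∪x≢⊥ eq = ∉⊥ (subst (x ∈_) eq (q⊆p∪q Y ⁅ x ⁆ (x∈⁅x⁆ x)))
    Y∪x∩X≡Y : (Y ∪ ⁅ x ⁆) ∩ X ≡ Y
    Y∪x∩X≡Y = begin
      (Y ∪ ⁅ x ⁆) ∩ X          ≡⟨ ∩-distribʳ-∪ X Y ⁅ x ⁆ ⟩
      (Y ∩ X) ∪ (⁅ x ⁆ ∩ X)    ≡⟨ cong₂ _∪_ (p⊆q⇒p∩q≡p Y⊆X) (x∉p⇒⁅x⁆∩p≡⊥ x∉X) ⟩
      Y ∪ ⊥                    ≡⟨ ∪-identityʳ Y ⟩
      Y                        ∎
  AlmostShatters⇒Shatters-⊂ {B} {X} (inj₂ h) (X⊆B , x , x∈B , x∉X) Y Y⊆X =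
    subst (InTrace 𝓕 X) (p⊆q⇒p∩q≡p Y⊆X) (InTrace-restrict X⊆B (from (h Y (X⊆B ∘ Y⊆X)) Y≢B))
    where
    Y≢B : Y ≢ B
    Y≢B refl = x∉X (Y⊆X x∈B)

  AlmostShatters⇒InTrace-⊥⊎InTrace-self : ∀ {B} → B ≢ ⊥ → AlmostShatters 𝓕 B →
                                          InTrace 𝓕 B ⊥ ⊎ InTrace 𝓕 B B
  AlmostShatters⇒InTrace-⊥⊎InTrace-self B≢⊥ (inj₁ h) = inj₂ (from (h _ ⊆-refl) B≢⊥)
  AlmostShatters⇒InTrace-⊥⊎InTrace-self B≢⊥ (inj₂ h) = inj₁ (from (h ⊥ ⊥⊆) (B≢⊥ ∘ sym))

  AlmostShatters-complete : ∀ {𝓖 A} → 𝓕 ⊑ 𝓖 → AlmostShatters 𝓕 A →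
                            InTrace 𝓖 A ⊥ → InTrace 𝓖 A A → Shatters 𝓖 A
  AlmostShatters-complete 𝓕⊑𝓖 (inj₁ h) ∅∈ _ Y Y⊆A with ⊆⇒≡⊎⊂ (⊥⊆ {p = Y})
  ... | inj₁ refl = ∅∈
  ... | inj₂ ⊥⊂Y = InTrace-mono 𝓕⊑𝓖 (from (h Y Y⊆A) (λ Y≡⊥ → ⊂-irref (sym Y≡⊥) ⊥⊂Y))
  AlmostShatters-complete 𝓕⊑𝓖 (inj₂ h) _ A∈ Y Y⊆A with ⊆⇒≡⊎⊂ Y⊆A
  ... | inj₁ refl = A∈
  ... | inj₂ Y⊂A = InTrace-mono 𝓕⊑𝓖 (from (h Y Y⊆A) (λ Y≡A → ⊂-irref Y≡A Y⊂A))

module _ (d′ : ℕ) {𝓕 : Family 0ℓ (2 * suc d′)}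
         (uniform : ∀ S → 𝓕 S → ∣ S ∣ ≡ suc d′)
         (almost : ∀ A → ∣ A ∣ ≡ suc d′ → AlmostShatters 𝓕 A) where

  private
    d : ℕ
    d = suc d′

    d≤2d : d ≤ 2 * d
    d≤2d = m≤m+n d (d + 0)

    2d∸d≡d : 2 * d ∸ d ≡ d
    2d∸d≡d = trans (m+n∸m≡n d (d + 0)) (+-identityʳ d)

  ∣∁p∣≡d : (p : Subset (2 * d)) → ∣ p ∣ ≡ d → ∣ ∁ p ∣ ≡ d
  ∣∁p∣≡d p ∣p∣≡d = trans (∣∁p∣≡n∸∣p∣ p) (trans (cong (2 * d ∸_) ∣p∣≡d) 2d∸d≡d)

  ∣∁p∣<d : (p : Subset (2 * d)) → d < ∣ p ∣ → ∣ ∁ p ∣ < d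
  ∣∁p∣<d p d<∣p∣ = subst₂ _<_ (sym (∣∁p∣≡n∸∣p∣ p)) 2d∸d≡d (∸-monoʳ-< d<∣p∣ (∣p∣≤n p))

  Shatters-proper-subset-of-d-set : ∀ {X} → ∣ X ∣ < d → Shatters 𝓕 X
  Shatters-proper-subset-of-d-set {X} ∣X∣<d
    with B , X⊆B , ∣B∣≡d ← ∃-superset-of-size X d (<⇒≤ ∣X∣<d) d≤2d
    = AlmostShatters⇒Shatters-⊂ (almost B ∣B∣≡d)
        (p⊆q∧∣p∣<∣q∣⇒p⊂q X⊆B (subst (∣ X ∣ <_) (sym ∣B∣≡d) ∣X∣<d))

  VC-lower : ∃ λ X → ∣ X ∣ ≡ d′ × Shatters 𝓕 X
  VC-lower
    with X , _ , ∣X∣≡d′ ← ∃-superset-of-size ⊥ d′ (subst (_≤ d′) (sym (∣⊥∣≡0 (2 * d))) z≤n)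
                                                  (≤-trans (n≤1+n d′) d≤2d)
    = X , ∣X∣≡d′ , Shatters-proper-subset-of-d-set (subst (_< d) (sym ∣X∣≡d′) (n<1+n d′))

  VC-upper : ∀ X → Shatters 𝓕 X → ∣ X ∣ ≤ d′
  VC-upper X sh with <-cmp ∣ X ∣ d
  ... | tri< ∣X∣<d _ _ = ≤-pred ∣X∣<d
  ... | tri≈ _ ∣X∣≡d _ = contradiction sh (AlmostShatters⇒¬Shatters (almost X ∣X∣≡d))
  ... | tri> _ _ d<∣X∣ with F , 𝓕F , X⊆F ← Shatters⇒⊆member sh
    = contradiction (subst (∣ X ∣ ≤_) (uniform F 𝓕F) (p⊆q⇒∣p∣≤∣q∣ X⊆F)) (<⇒≱ d<∣X∣)

  VCGt-of-completed-d-set : ∀ {𝓕′} → 𝓕 ⊑ 𝓕′ → ∀ A → ∣ A ∣ ≡ d →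
                            InTrace 𝓕′ A ⊥ → InTrace 𝓕′ A A → VCGt 𝓕′ d′
  VCGt-of-completed-d-set 𝓕⊑𝓕′ A ∣A∣≡d ∅∈ A∈ =
    A , subst (d′ <_) (sym ∣A∣≡d) (n<1+n d′) , AlmostShatters-complete 𝓕⊑𝓕′ (almost A ∣A∣≡d) ∅∈ A∈

  VC-extension : ∀ 𝓕′ → 𝓕 ⊏ 𝓕′ → VCGt 𝓕′ d′
  VC-extension 𝓕′ (𝓕⊑𝓕′ , S , 𝓕′S , ¬𝓕S) with <-cmp ∣ S ∣ d
  ... | tri< ∣S∣<d _ _ with G , 𝓕G , G∩S≡⊥ ← Shatters-proper-subset-of-d-set ∣S∣<d ⊥ ⊥⊆
    = VCGt-of-completed-d-set 𝓕⊑𝓕′ G (uniform G 𝓕G)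
        (S , 𝓕′S , trans (∩-comm S G) G∩S≡⊥)
        (G , 𝓕⊑𝓕′ G 𝓕G , ∩-idem G)
  ... | tri≈ _ ∣S∣≡d _ with AlmostShatters⇒InTrace-⊥⊎InTrace-self S≢⊥ (almost S ∣S∣≡d)
    where
    S≢⊥ : S ≢ ⊥
    S≢⊥ = 0<∣p∣⇒p≢⊥ (subst (0 <_) (sym ∣S∣≡d) (s≤s z≤n))
  ...   | inj₁ ∅∈ =
    VCGt-of-completed-d-set 𝓕⊑𝓕′ S ∣S∣≡d (InTrace-mono 𝓕⊑𝓕′ ∅∈) (S , 𝓕′S , ∩-idem S)
  ...   | inj₂ (G , 𝓕G , G∩S≡S) = contradiction (subst 𝓕 (sym S≡G) 𝓕G) ¬𝓕S
    where
    S≡G : S ≡ G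
    S≡G = p⊆q∧∣q∣≤∣p∣⇒p≡q (p∩q≡q⇒q⊆p G∩S≡S) (≤-reflexive (trans (uniform G 𝓕G) (sym ∣S∣≡d)))
  VC-extension 𝓕′ (𝓕⊑𝓕′ , S , 𝓕′S , ¬𝓕S) | tri> _ _ d<∣S∣
    with G , 𝓕G , ∁S⊆G ← Shatters⇒⊆member (Shatters-proper-subset-of-d-set (∣∁p∣<d S d<∣S∣))
    = VCGt-of-completed-d-set 𝓕⊑𝓕′ (∁ G) (∣∁p∣≡d G (uniform G 𝓕G))
        (G , 𝓕⊑𝓕′ G 𝓕G , ∩-inverseʳ G)
        (S , 𝓕′S , trans (∩-comm S (∁ G)) (p⊆q⇒p∩q≡p (∁p⊆q⇒∁q⊆p ∁S⊆G)))

proposition2 : (d : ℕ) → 1 ≤ d → (𝓕 : Family 0ℓ (2 * d)) →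
    (∀ S → 𝓕 S → ∣ S ∣ ≡ d) →
    (∀ (A : Subset (2 * d)) → ∣ A ∣ ≡ d → AlmostShatters 𝓕 A) →
    Saturated (d ∸ 1) 𝓕
proposition2 (suc d′) _ 𝓕 uniform almost =
  (VC-lower d′ uniform almost , VC-upper d′ uniform almost) , VC-extension d′ uniform almost
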